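{- Let $\vec{x}=(x_1,\ldots,x_t)$ be a generalized Catalan list of nonzero integers with $2y$ runs. If ${\sf cost}(\vec{x})={\sf width}(\vec{x})$ and $y>1$, then $\vec{x}$ is reducible.
   Context: A list $\vec{x}=(x_1,\ldots,x_t)$ of nonzero integers is generalized Catalan if $\sum_{i=1}^t x_i=0$ and $\sum_{i=1}^q x_i\ge0$ for all $1\le q\le t$. A sublist is $(x_{i_1},\ldots,x_{i_a})$ with $i_1<\cdots<i_a$; its complementary sublist consists of the remaining entries in order. $\vec{x}$ is reducible if there is a generalized Catalan sublist whose complementary sublist is also generalized Catalan. A run is a maximal consecutive sublist of entries of the same sign; a generalized Catalan list has an even number $2y$ of runs. If $a_k>0$ is the maximum absolute value of an entry in the $k$-th run, ${\sf cost}(\vec{x})=\sum_{k=1}^{2y}a_k$ and ${\sf width}(\vec{x})=t$. -}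

module Defs where

open import Data.Bool using (Bool; true; false; if_then_else_; not; _xor_)
open import Data.Nat as ℕ using (ℕ; _⊔_)
open import Data.Integer using (ℤ; 0ℤ; ∣_∣; _<?_; _≤_)
open import Data.List using (List; []; _∷_; [_]; length; take; map; foldr)
open import Data.Nat.ListAction using (sum)
import Data.Integer as ℤ
open import Data.List.NonEmpty using (List⁺; _∷_; toList)
open import Data.List.Relation.Ternary.Interleaving.Propositional using (Interleaving)
open import Data.Product using (∃₂; _×_)
open import Relation.Nullary.Decidable using (⌊_⌋)
open import Relation.Binary.PropositionalEquality using (_≡_)

sumℤ : List ℤ → ℤ
sumℤ = foldr ℤ._+_ 0ℤ

record GenCatalan (xs : List ℤ) : Set where
  field
    nonempty   : 1 ℕ.≤ length xs
    sumZero    : sumℤ xs ≡ 0ℤ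
    prefixNonneg : ∀ q → 1 ℕ.≤ q → q ℕ.≤ length xs → 0ℤ ≤ sumℤ (take q xs)

-- xs is reducible: it splits into a sublist l and its complementary sublist r
-- (i.e. xs is an interleaving of l and r, order preserved), both generalized Catalan.
Reducible : List ℤ → Set
Reducible xs = ∃₂ λ l r → Interleaving l r xs × GenCatalan l × GenCatalan r

isPos : ℤ → Bool
isPos x = ⌊ 0ℤ <? x ⌋

sameSign : ℤ → ℤ → Bool
sameSign x y = not (isPos x xor isPos y)

runs : List ℤ → List (List⁺ ℤ)
runs [] = []
runs (x ∷ xs) with runs xs
... | [] = [ x ∷ [] ]
... | (z ∷ r) ∷ rs = if sameSign x z then (x ∷ z ∷ r) ∷ rs else (x ∷ []) ∷ (z ∷ r) ∷ rs

maxAbs : List⁺ ℤ → ℕ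
maxAbs r = foldr _⊔_ 0 (map ∣_∣ (toList r))

cost : List ℤ → ℕ
cost xs = sum (map maxAbs (runs xs))

width : List ℤ → ℕ
width = length

-- Read xs as a path with heights h q = x₁ + ⋯ + x_q, so h ≥ 0 and h t = 0 (t the width).
-- If the signs are + ⋯ + − ⋯ − there are at most two runs, against y > 1; otherwise there
-- is a valley x_p < 0 < x_{p+1}, and if the path touches 0 there the prefix splits off.
-- Else each of t + 1 items (the up-steps, the rise after the valley, and the down-steps,
-- which are up-steps of the reversed path) yields a level τ the path climbs to and the
-- first step c that leaves it downward, at depth h c - h τ < ∣x_c∣.  Numbering such
-- (step, depth) pairs run by run, below each run's maximal ∣x∣, codes them below
-- cost = t; so two items collide: equal depths with both exits in one run.  Then the
-- climb between the two levels and the descent between the two exits form a generalized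
-- Catalan sublist, and so does its complement.

module Submission where

open import Defs
open import Data.Bool using (Bool; true; false; not; _xor_; T; if_then_else_)
open import Data.Empty using (⊥; ⊥-elim)
open import Data.Fin using (toℕ; fromℕ<)
import Data.Fin.Properties as Fin
open import Data.Integer as ℤ using (ℤ; 0ℤ; ∣_∣; _+_; _-_; _≤_; _<_)
import Data.Integer.Properties as ℤ
open import Data.Integer.Tactic.RingSolver using (solve-∀)
open import Data.List using (List; []; _∷_; length; take; drop; map; _++_)
import Data.List.Properties as List
open import Data.List.NonEmpty using (_∷_)
import Data.List.Relation.Binary.Pointwise as Pointwise
import Data.List.Relation.Ternary.Interleaving as Interleaving
open import Data.List.Relation.Ternary.Interleaving.Properties using (++⁺)
open import Data.List.Relation.Ternary.Interleaving.Propositional using (Interleaving)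
open import Data.List.Relation.Unary.All using (All; []; _∷_)
open import Data.Nat as ℕ using (ℕ; zero; suc; z≤n; s≤s; _∸_; _⊔_; _*_)
import Data.Nat.Properties as ℕ
open import Data.Nat.ListAction using (sum)
import Data.Nat.Tactic.RingSolver as ℕ-Solver
open import Data.Product using (Σ-syntax; ∃-syntax; ∃₂; _×_; _,_; proj₁)
open import Data.Sum using (_⊎_; inj₁; inj₂)
open import Data.Unit using (⊤; tt)
open import Function using (_∘_)
open import Relation.Binary using (tri<; tri≈; tri>)
open import Relation.Binary.PropositionalEquality
open import Relation.Nullary using (yes; no)
open import Relation.Nullary.Decidable using (isYes≗does; dec-true; dec-false; toWitness; toWitnessFalse)

height : List ℤ → ℕ → ℤ
height xs q = sumℤ (take q xs)

entry : List ℤ → ℕ → ℤ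
entry []       _       = 0ℤ
entry (x ∷ xs) zero    = x
entry (x ∷ xs) (suc n) = entry xs n

height-suc : ∀ xs q → height xs (suc q) ≡ height xs q + entry xs q
height-suc []       zero    = refl
height-suc []       (suc q) = refl
height-suc (x ∷ xs) zero    = ℤ.+-comm x 0ℤ
height-suc (x ∷ xs) (suc q) = trans (cong (x +_) (height-suc xs q)) (sym (ℤ.+-assoc x _ _))

height-+ : ∀ xs j q → height xs (j ℕ.+ q) ≡ height xs j + height (drop j xs) q
height-+ xs       zero    q       = sym (ℤ.+-identityˡ _)
height-+ []       (suc j) zero    = refl
height-+ []       (suc j) (suc q) = refl
height-+ (x ∷ xs) (suc j) q       = trans (cong (x +_) (height-+ xs j q)) (sym (ℤ.+-assoc x _ _))

height-drop : ∀ xs j q → height (drop j xs) q ≡ height xs (j ℕ.+ q) - height xs j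
height-drop xs j q = begin
  height (drop j xs) q                                ≡⟨ cancel (height xs j) _ ⟩
  (height xs j + height (drop j xs) q) - height xs j  ≡⟨ cong (_- height xs j) (height-+ xs j q) ⟨
  height xs (j ℕ.+ q) - height xs j                   ∎
  where
  open ≡-Reasoning
  cancel : ∀ a b → b ≡ (a + b) - a
  cancel = solve-∀

height-length : ∀ xs → height xs (length xs) ≡ sumℤ xs
height-length xs = cong sumℤ (List.take-all (length xs) xs ℕ.≤-refl)

genCatalan-height-nonneg : ∀ {xs} → GenCatalan xs → ∀ q → 0ℤ ≤ height xs q
genCatalan-height-nonneg         gc zero    = ℤ.≤-refl
genCatalan-height-nonneg {xs} gc (suc q) with suc q ℕ.≤? length xs
... | yes q<t = GenCatalan.prefixNonneg gc (suc q) (s≤s z≤n) q<t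
... | no  q≮t = ℤ.≤-reflexive (sym (trans (cong sumℤ (List.take-all (suc q) xs (ℕ.<⇒≤ (ℕ.≰⇒> q≮t))))
                                           (GenCatalan.sumZero gc)))

genCatalan-height-end : ∀ {xs} → GenCatalan xs → height xs (length xs) ≡ 0ℤ
genCatalan-height-end {xs} gc = trans (height-length xs) (GenCatalan.sumZero gc)

height-rises : ∀ xs {u} → 0ℤ < entry xs u → height xs u < height xs (suc u)
height-rises xs {u} 0<x = subst (height xs u <_) (sym (height-suc xs u))
  (subst (_< height xs u + entry xs u) (ℤ.+-identityʳ _) (ℤ.+-monoʳ-< (height xs u) 0<x))

height-falls : ∀ xs {u} → entry xs u < 0ℤ → height xs (suc u) < height xs u
height-falls xs {u} x<0 = subst (_< height xs u) (sym (height-suc xs u))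
  (subst (height xs u + entry xs u <_) (ℤ.+-identityʳ _) (ℤ.+-monoʳ-< (height xs u) x<0))

rises⇒entry-pos : ∀ xs {u} → height xs u < height xs (suc u) → 0ℤ < entry xs u
rises⇒entry-pos xs {u} rise = ℤ.≰⇒> λ x≤0 → ℤ.<⇒≱ rise
  (subst₂ _≤_ (sym (height-suc xs u)) (ℤ.+-identityʳ _) (ℤ.+-monoʳ-≤ (height xs u) x≤0))

falls⇒entry-neg : ∀ xs {u} → height xs (suc u) < height xs u → entry xs u < 0ℤ
falls⇒entry-neg xs {u} fall = ℤ.≰⇒> λ 0≤x → ℤ.<⇒≱ fall
  (subst₂ _≤_ (ℤ.+-identityʳ _) (sym (height-suc xs u)) (ℤ.+-monoʳ-≤ (height xs u) 0≤x))

∣entry∣≡∣height-diff∣ : ∀ xs u → ∣ entry xs u ∣ ≡ ∣ height xs (suc u) - height xs u ∣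
∣entry∣≡∣height-diff∣ xs u =
  cong ∣_∣ (trans (cancel (height xs u) (entry xs u)) (cong (_- height xs u) (sym (height-suc xs u))))
  where
  cancel : ∀ a x → x ≡ (a + x) - a
  cancel = solve-∀

gap-< : ∀ {a b c} → a < b → b ≤ c → ∣ c - b ∣ ℕ.< ∣ c - a ∣
gap-< {a} {b} {c} a<b b≤c =
  ℤ.drop‿+<+ (subst₂ _<_ (sym (ℤ.0≤i⇒+∣i∣≡i 0≤c-b)) (sym (ℤ.0≤i⇒+∣i∣≡i 0≤c-a)) c-b<c-a)
  where
  c-b<c-a : c - b < c - a
  c-b<c-a = ℤ.+-monoʳ-< c (ℤ.neg-mono-< a<b)
  0≤c-b : 0ℤ ≤ c - b
  0≤c-b = ℤ.i≤j⇒0≤j-i b≤c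
  0≤c-a : 0ℤ ≤ c - a
  0≤c-a = ℤ.≤-trans 0≤c-b (ℤ.<⇒≤ c-b<c-a)

segment : ℕ → ℕ → List ℤ → List ℤ
segment j k xs = take (k ∸ j) (drop j xs)

drop-segment : ∀ xs {j k} → j ℕ.≤ k → drop j xs ≡ segment j k xs ++ drop k xs
drop-segment xs {j} {k} j≤k = begin
  drop j xs                                   ≡⟨ List.take++drop≡id (k ∸ j) (drop j xs) ⟨
  segment j k xs ++ drop (k ∸ j) (drop j xs)  ≡⟨ cong (segment j k xs ++_) (List.drop-drop j (k ∸ j) xs) ⟩
  segment j k xs ++ drop (j ℕ.+ (k ∸ j)) xs   ≡⟨ cong (λ i → segment j k xs ++ drop i xs) (ℕ.m+[n∸m]≡n j≤k) ⟩
  segment j k xs ++ drop k xs                 ∎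
  where open ≡-Reasoning

segment-nonempty : ∀ {j k} xs → j ℕ.< k → k ℕ.≤ length xs → 1 ℕ.≤ length (segment j k xs)
segment-nonempty {j} {k} xs j<k k≤t = begin
  1                                   ≤⟨ ℕ.⊓-glb (ℕ.m<n⇒0<n∸m j<k) (ℕ.m<n⇒0<n∸m (ℕ.<-≤-trans j<k k≤t)) ⟩
  (k ∸ j) ℕ.⊓ (length xs ∸ j)         ≡⟨ cong ((k ∸ j) ℕ.⊓_) (List.length-drop j xs) ⟨
  (k ∸ j) ℕ.⊓ length (drop j xs)      ≡⟨ List.length-take (k ∸ j) (drop j xs) ⟨
  length (segment j k xs)             ∎
  where open ℕ.≤-Reasoning

WalkToZero : ℤ → List ℤ → Set
WalkToZero h₀ []       = h₀ ≡ 0ℤ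
WalkToZero h₀ (z ∷ zs) = 0ℤ ≤ h₀ + z × WalkToZero (h₀ + z) zs

walkToZero-sum : ∀ h₀ zs → WalkToZero h₀ zs → h₀ + sumℤ zs ≡ 0ℤ
walkToZero-sum h₀ []       w       = trans (ℤ.+-identityʳ h₀) w
walkToZero-sum h₀ (z ∷ zs) (_ , w) = trans (sym (ℤ.+-assoc h₀ z (sumℤ zs))) (walkToZero-sum (h₀ + z) zs w)

walkToZero-height : ∀ h₀ zs → WalkToZero h₀ zs → ∀ q → 0ℤ ≤ h₀ + height zs (suc q)
walkToZero-height h₀ []       w       q       = ℤ.≤-reflexive (sym (trans (ℤ.+-identityʳ h₀) w))
walkToZero-height h₀ (z ∷ zs) (p , w) zero    = subst (λ v → 0ℤ ≤ h₀ + v) (sym (ℤ.+-identityʳ z)) p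
walkToZero-height h₀ (z ∷ zs) (p , w) (suc q) =
  subst (0ℤ ≤_) (ℤ.+-assoc h₀ z (height zs (suc q))) (walkToZero-height (h₀ + z) zs w q)

walkToZero⇒genCatalan : ∀ zs → 1 ℕ.≤ length zs → WalkToZero 0ℤ zs → GenCatalan zs
walkToZero⇒genCatalan zs nonempty w = record
  { nonempty     = nonempty
  ; sumZero      = trans (sym (ℤ.+-identityˡ _)) (walkToZero-sum 0ℤ zs w)
  ; prefixNonneg = λ { (suc q) _ _ → subst (0ℤ ≤_) (ℤ.+-identityˡ _) (walkToZero-height 0ℤ zs w q) }
  }

walkToZero-take++ : ∀ ys rest h₀ n → (∀ q → 1 ℕ.≤ q → q ℕ.≤ n → 0ℤ ≤ h₀ + height ys q) →
                    WalkToZero (h₀ + height ys n) rest → WalkToZero h₀ (take n ys ++ rest)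
walkToZero-take++ ys       rest h₀ zero    _     w = subst (λ v → WalkToZero v rest) (ℤ.+-identityʳ h₀) w
walkToZero-take++ []       rest h₀ (suc n) _     w = subst (λ v → WalkToZero v rest) (ℤ.+-identityʳ h₀) w
walkToZero-take++ (y ∷ ys) rest h₀ (suc n) above w =
  subst (λ v → 0ℤ ≤ h₀ + v) (ℤ.+-identityʳ y) (above 1 ℕ.≤-refl (s≤s z≤n)) ,
  walkToZero-take++ ys rest (h₀ + y) n
    (λ q 1≤q q≤n → subst (0ℤ ≤_) (sym (ℤ.+-assoc h₀ y (height ys q))) (above (suc q) (s≤s z≤n) (s≤s q≤n)))
    (subst (λ v → WalkToZero v rest) (sym (ℤ.+-assoc h₀ y (height ys n))) w)

walkToZero-segment : ∀ xs j k h₀ rest → j ℕ.≤ k →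
                     (∀ q → j ℕ.< q → q ℕ.≤ k → 0ℤ ≤ h₀ + (height xs q - height xs j)) →
                     WalkToZero (h₀ + (height xs k - height xs j)) rest →
                     WalkToZero h₀ (segment j k xs ++ rest)
walkToZero-segment xs j _ h₀ rest j≤k above w with ℕ.m≤n⇒∃[o]m+o≡n j≤k
... | n , refl rewrite ℕ.m+n∸m≡n j n =
  walkToZero-take++ (drop j xs) rest h₀ n
    (λ q 1≤q q≤n → subst (λ v → 0ℤ ≤ h₀ + v) (sym (height-drop xs j q))
                     (above (j ℕ.+ q) (ℕ.m<m+n j 1≤q) (ℕ.+-monoʳ-≤ j q≤n)))
    (subst (λ v → WalkToZero (h₀ + v) rest) (sym (height-drop xs j n)) w)

nonempty-++ˡ : ∀ (xs ys : List ℤ) → 1 ℕ.≤ length xs → 1 ℕ.≤ length (xs ++ ys)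
nonempty-++ˡ (_ ∷ _) _ _ = s≤s z≤n

nonempty-++ʳ : ∀ (xs ys : List ℤ) → 1 ℕ.≤ length ys → 1 ℕ.≤ length (xs ++ ys)
nonempty-++ʳ []      _ ne = ne
nonempty-++ʳ (_ ∷ _) _ _  = s≤s z≤n

-- Indices a ≤ b ≤ c ≤ d ≤ t cutting the height profile h of a list of width t so
-- that x_{a+1..b} ++ x_{c+1..d} and its complementary sublist are both
-- generalized Catalan; h b - h a is the height the first block climbs.
record Splitting (h : ℕ → ℤ) (t : ℕ) : Set where
  field
    a b c d        : ℕ
    a≤b            : a ℕ.≤ b
    b≤c            : b ℕ.≤ c
    c≤d            : c ℕ.≤ d
    d≤t            : d ℕ.≤ t
    inner-nonempty : a ℕ.< b ⊎ c ℕ.< d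
    outer-nonempty : 1 ℕ.≤ a ⊎ d ℕ.< t
    B-above        : ∀ q → a ℕ.≤ q → q ℕ.≤ b → h a ≤ h q
    C-above        : ∀ q → b ℕ.≤ q → q ℕ.≤ c → h b - h a ≤ h q
    D-above        : ∀ q → c ℕ.≤ q → q ℕ.≤ d → 0ℤ ≤ (h b - h a) + (h q - h c)
    balanced       : (h b - h a) + (h d - h c) ≡ 0ℤ

splitting⇒reducible : ∀ xs → (∀ q → 0ℤ ≤ height xs q) → sumℤ xs ≡ 0ℤ →
                      Splitting (height xs) (length xs) → Reducible xs
splitting⇒reducible xs nonneg sum≡0 s =
  B ++ (D ++ []) , A ++ (C ++ (E ++ [])) , interleaving ,
  walkToZero⇒genCatalan _ inner-nonempty′ inner-walk ,
  walkToZero⇒genCatalan _ outer-nonempty′ outer-walk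
  where
  open Splitting s
  h = height xs
  t = length xs
  A = segment 0 a xs
  B = segment a b xs
  C = segment b c xs
  D = segment c d xs
  E = segment d t xs

  decomposition : xs ≡ A ++ (B ++ (C ++ (D ++ (E ++ []))))
  decomposition =
    trans (drop-segment xs {k = a} z≤n) (cong (A ++_)
    (trans (drop-segment xs a≤b) (cong (B ++_)
    (trans (drop-segment xs b≤c) (cong (C ++_)
    (trans (drop-segment xs c≤d) (cong (D ++_)
    (trans (drop-segment xs d≤t) (cong (E ++_) (List.drop-all t xs ℕ.≤-refl))))))))))

  alone : ∀ ys → Interleaving ys [] ys
  alone ys = Interleaving.left (Pointwise.≡⇒Pointwise-≡ refl)

  aside : ∀ ys → Interleaving [] ys ys
  aside ys = Interleaving.right (Pointwise.≡⇒Pointwise-≡ refl)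

  interleaving : Interleaving (B ++ (D ++ [])) (A ++ (C ++ (E ++ []))) xs
  interleaving = subst (Interleaving _ _) (sym decomposition)
    (++⁺ (aside A) (++⁺ (alone B) (++⁺ (aside C) (++⁺ (alone D) (aside (E ++ []))))))

  δ = h b - h a

  0≤0+[y-x] : ∀ {x y} → x ≤ y → 0ℤ ≤ 0ℤ + (y - x)
  0≤0+[y-x] x≤y = subst (0ℤ ≤_) (sym (ℤ.+-identityˡ _)) (ℤ.i≤j⇒0≤j-i x≤y)

  inner-walk : WalkToZero 0ℤ (B ++ (D ++ []))
  inner-walk = walkToZero-segment xs a b 0ℤ (D ++ []) a≤b
    (λ q a<q q≤b → 0≤0+[y-x] (B-above q (ℕ.<⇒≤ a<q) q≤b))
    (walkToZero-segment xs c d (0ℤ + δ) [] c≤d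
      (λ q c<q q≤d → subst (λ v → 0ℤ ≤ v + (h q - h c)) (sym (ℤ.+-identityˡ δ)) (D-above q (ℕ.<⇒≤ c<q) q≤d))
      (trans (cong (_+ (h d - h c)) (ℤ.+-identityˡ δ)) balanced))

  outer-walk : WalkToZero 0ℤ (A ++ (C ++ (E ++ [])))
  outer-walk = walkToZero-segment xs 0 a 0ℤ (C ++ (E ++ [])) z≤n
    (λ q _ _ → 0≤0+[y-x] (nonneg q))
    (walkToZero-segment xs b c (0ℤ + (h a - 0ℤ)) (E ++ []) b≤c
      (λ q b<q q≤c → subst (0ℤ ≤_) (after-A (h q)) (ℤ.i≤j⇒0≤j-i (C-above q (ℕ.<⇒≤ b<q) q≤c)))
      (walkToZero-segment xs d t (0ℤ + (h a - 0ℤ) + (h c - h b)) [] d≤t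
        (λ q _ _ → subst (0ℤ ≤_) (sym (after-C (h q))) (nonneg q))
        (trans (after-C (h t)) (trans (height-length xs) sum≡0))))
    where
    shift : ∀ x y z → z - (y - x) ≡ 0ℤ + (x - 0ℤ) + (z - y)
    shift = solve-∀
    after-A : ∀ z → z - δ ≡ 0ℤ + (h a - 0ℤ) + (z - h b)
    after-A = shift (h a) (h b)
    rebalance : ∀ x y z w u → 0ℤ + (x - 0ℤ) + (z - y) + (u - w) ≡ u - ((y - x) + (w - z))
    rebalance = solve-∀
    after-C : ∀ z → 0ℤ + (h a - 0ℤ) + (h c - h b) + (z - h d) ≡ z
    after-C z = trans (rebalance (h a) (h b) (h c) (h d) z)
                      (trans (cong (z -_) balanced) (ℤ.+-identityʳ z))

  inner-nonempty′ : 1 ℕ.≤ length (B ++ (D ++ []))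
  inner-nonempty′ with inner-nonempty
  ... | inj₁ a<b = nonempty-++ˡ B _ (segment-nonempty xs a<b (ℕ.≤-trans b≤c (ℕ.≤-trans c≤d d≤t)))
  ... | inj₂ c<d = nonempty-++ʳ B _ (nonempty-++ˡ D _ (segment-nonempty xs c<d d≤t))

  outer-nonempty′ : 1 ℕ.≤ length (A ++ (C ++ (E ++ [])))
  outer-nonempty′ with outer-nonempty
  ... | inj₁ 0<a = nonempty-++ˡ A _ (segment-nonempty xs 0<a (ℕ.≤-trans a≤b (ℕ.≤-trans b≤c (ℕ.≤-trans c≤d d≤t))))
  ... | inj₂ d<t = nonempty-++ʳ A _ (nonempty-++ʳ C _ (nonempty-++ˡ E _ (segment-nonempty xs d<t ℕ.≤-refl)))

Between : ℕ → ℕ → ℕ → Set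
Between a b u = (a ℕ.≤ u × u ℕ.≤ b) ⊎ (b ℕ.≤ u × u ℕ.≤ a)

between-sym : ∀ {a b u} → Between a b u → Between b a u
between-sym (inj₁ p) = inj₂ p
between-sym (inj₂ p) = inj₁ p

between-right : ∀ a b → Between a b b
between-right a b with ℕ.≤-total a b
... | inj₁ a≤b = inj₁ (a≤b , ℕ.≤-refl)
... | inj₂ b≤a = inj₂ (ℕ.≤-refl , b≤a)

between-< : ∀ {a b u n} → a ℕ.< n → b ℕ.< n → Between a b u → u ℕ.< n
between-< _   b<n (inj₁ (_ , u≤b)) = ℕ.≤-<-trans u≤b b<n
between-< a<n _   (inj₂ (_ , u≤a)) = ℕ.≤-<-trans u≤a a<n

between-mirror : ∀ t {a b u} → Between a b u → Between (t ∸ suc a) (t ∸ suc b) (t ∸ suc u)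
between-mirror t (inj₁ (a≤u , u≤b)) = inj₂ (ℕ.∸-monoʳ-≤ t (s≤s u≤b) , ℕ.∸-monoʳ-≤ t (s≤s a≤u))
between-mirror t (inj₂ (b≤u , u≤a)) = inj₁ (ℕ.∸-monoʳ-≤ t (s≤s u≤a) , ℕ.∸-monoʳ-≤ t (s≤s b≤u))

module _ (h : ℕ → ℤ) where

  record FirstExit (τ c : ℕ) : Set where
    field
      τ≤c   : τ ℕ.≤ c
      drops : h (suc c) < h τ
      above : ∀ q → τ ℕ.≤ q → q ℕ.≤ c → h τ ≤ h q

  AtUpStep : ℕ → Set
  AtUpStep zero    = ⊥
  AtUpStep (suc p) = h p < h (suc p) ⊎ h (suc p) < h (suc (suc p))

  FallsOn : ℕ → ℕ → Set
  FallsOn lo hi = ∀ u → lo ℕ.≤ u → u ℕ.≤ hi → h (suc u) < h u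

  FallsBetween : ℕ → ℕ → Set
  FallsBetween c₁ c₂ = ∀ u → Between c₁ c₂ u → h (suc u) < h u

  firstExit-from : ∀ τ s k → τ ℕ.≤ s → (∀ q → τ ℕ.≤ q → q ℕ.≤ s → h τ ≤ h q) →
                   h (s ℕ.+ k) < h τ → ∃[ c ] FirstExit τ c × c ℕ.< s ℕ.+ k
  firstExit-from τ s zero    τ≤s above below rewrite ℕ.+-identityʳ s =
    ⊥-elim (ℤ.<⇒≱ below (above s τ≤s ℕ.≤-refl))
  firstExit-from τ s (suc k) τ≤s above below rewrite ℕ.+-suc s k with h (suc s) ℤ.<? h τ
  ... | yes drops = s , record { τ≤c = τ≤s ; drops = drops ; above = above } , s≤s (ℕ.m≤m+n s k)
  ... | no ¬drops = firstExit-from τ (suc s) k (ℕ.m≤n⇒m≤1+n τ≤s) above′ below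
    where
    above′ : ∀ q → τ ℕ.≤ q → q ℕ.≤ suc s → h τ ≤ h q
    above′ q τ≤q q≤1+s with ℕ.m≤n⇒m<n∨m≡n q≤1+s
    ... | inj₁ (s≤s q≤s) = above q τ≤q q≤s
    ... | inj₂ refl      = ℤ.≮⇒≥ ¬drops

  firstExit : ∀ {τ t} → τ ℕ.≤ t → h t < h τ → ∃[ c ] FirstExit τ c × c ℕ.< t
  firstExit {τ} {t} τ≤t below with ℕ.m≤n⇒∃[o]m+o≡n τ≤t
  ... | k , refl = firstExit-from τ τ k ℕ.≤-refl
                     (λ q τ≤q q≤τ → ℤ.≤-reflexive (cong h (ℕ.≤-antisym τ≤q q≤τ))) below

  fallsOn-≤ : ∀ {lo} hi q → FallsOn lo hi → lo ℕ.≤ q → q ℕ.≤ hi → h hi ≤ h q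
  fallsOn-≤ zero     zero _     _    _      = ℤ.≤-refl
  fallsOn-≤ (suc hi) q    falls lo≤q q≤1+hi with ℕ.m≤n⇒m<n∨m≡n q≤1+hi
  ... | inj₂ refl        = ℤ.≤-refl
  ... | inj₁ (s≤s q≤hi) =
    ℤ.≤-trans (ℤ.<⇒≤ (falls hi (ℕ.≤-trans lo≤q q≤hi) (ℕ.n≤1+n hi)))
              (fallsOn-≤ hi q (λ u lo≤u u≤hi → falls u lo≤u (ℕ.m≤n⇒m≤1+n u≤hi)) lo≤q q≤hi)

  fallsOn-noUpStep : ∀ {lo hi} τ → FallsOn lo hi → lo ℕ.< τ → τ ℕ.≤ hi → AtUpStep τ → ⊥
  fallsOn-noUpStep (suc p) falls (s≤s lo≤p) τ≤hi (inj₁ rise) =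
    ℤ.<-asym rise (falls p lo≤p (ℕ.≤-trans (ℕ.n≤1+n p) τ≤hi))
  fallsOn-noUpStep (suc p) falls (s≤s lo≤p) τ≤hi (inj₂ rise) =
    ℤ.<-asym rise (falls (suc p) (ℕ.m≤n⇒m≤1+n lo≤p) τ≤hi)

  upStep⇒≥1 : ∀ {τ} → AtUpStep τ → 1 ℕ.≤ τ
  upStep⇒≥1 {suc _} _ = s≤s z≤n

  upStep≤exit : ∀ {τ c₁ c₂} → AtUpStep τ → τ ℕ.≤ c₂ → FallsBetween c₁ c₂ → τ ℕ.≤ c₁
  upStep≤exit {τ} {c₁} up τ≤c₂ falls with τ ℕ.≤? c₁
  ... | yes τ≤c₁ = τ≤c₁
  ... | no  τ≰c₁ =
    ⊥-elim (fallsOn-noUpStep τ (λ u c₁≤u u≤c₂ → falls u (inj₁ (c₁≤u , u≤c₂))) (ℕ.≰⇒> τ≰c₁) τ≤c₂ up)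

module _ (h : ℕ → ℤ) (t : ℕ) (nonneg : ∀ q → 0ℤ ≤ h q) where

  excursion⇒splitting : ∀ a b → a ℕ.< b → b ℕ.≤ t → 1 ℕ.≤ a ⊎ b ℕ.< t →
                        (∀ q → a ℕ.≤ q → q ℕ.≤ b → h a ≤ h q) → h a ≡ h b → Splitting h t
  excursion⇒splitting a b a<b b≤t outer above ha≡hb = record
    { a = a ; b = b ; c = b ; d = b
    ; a≤b = ℕ.<⇒≤ a<b ; b≤c = ℕ.≤-refl ; c≤d = ℕ.≤-refl ; d≤t = b≤t
    ; inner-nonempty = inj₁ a<b
    ; outer-nonempty = outer
    ; B-above        = above
    ; C-above        = λ q _ _ → subst (_≤ h q) (sym rise≡0) (nonneg q)
    ; D-above        = λ { q b≤q q≤b → subst (λ r → 0ℤ ≤ (h b - h a) + (h r - h b)) (ℕ.≤-antisym b≤q q≤b)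
                                         (ℤ.≤-reflexive (sym balanced)) }
    ; balanced       = balanced
    }
    where
    rise≡0 : h b - h a ≡ 0ℤ
    rise≡0 = trans (cong (h b -_) ha≡hb) (ℤ.+-inverseʳ (h b))
    balanced : (h b - h a) + (h b - h b) ≡ 0ℤ
    balanced = cong₂ _+_ rise≡0 (ℤ.+-inverseʳ (h b))

  open FirstExit

  -- The inner sublist climbs from level h τ₁ to h τ₂ and then follows the descent
  -- from c₂ to c₁, which by the equal gaps drops by exactly h τ₂ - h τ₁.
  nestedExits⇒splitting : ∀ {τ₁ τ₂ c₁ c₂} → FirstExit h τ₁ c₁ → FirstExit h τ₂ c₂ →
                          1 ℕ.≤ τ₁ → τ₁ ℕ.< τ₂ → τ₂ ℕ.≤ c₁ → c₁ ℕ.< t → h τ₁ < h τ₂ →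
                          FallsBetween h c₁ c₂ → h c₁ - h τ₁ ≡ h c₂ - h τ₂ → Splitting h t
  nestedExits⇒splitting {τ₁} {τ₂} {c₁} {c₂} e₁ e₂ 1≤τ₁ τ₁<τ₂ τ₂≤c₁ c₁<t lower falls same-gap = record
    { a = τ₁ ; b = τ₂ ; c = c₂ ; d = c₁
    ; a≤b = ℕ.<⇒≤ τ₁<τ₂ ; b≤c = τ≤c e₂ ; c≤d = ℕ.<⇒≤ c₂<c₁ ; d≤t = ℕ.<⇒≤ c₁<t
    ; inner-nonempty = inj₁ τ₁<τ₂
    ; outer-nonempty = inj₁ 1≤τ₁
    ; B-above  = λ q τ₁≤q q≤τ₂ → above e₁ q τ₁≤q (ℕ.≤-trans q≤τ₂ τ₂≤c₁)
    ; C-above  = λ q τ₂≤q q≤c₂ →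
        ℤ.≤-trans (ℤ.i-j≤i (h τ₂) (h τ₁) {{ℤ.nonNegative (nonneg τ₁)}}) (above e₂ q τ₂≤q q≤c₂)
    ; D-above  = λ q c₂≤q q≤c₁ → subst (0ℤ ≤_) (sym (shift (h q)))
        (ℤ.i≤j⇒0≤j-i (fallsOn-≤ h c₁ q (λ u c₂≤u u≤c₁ → falls u (inj₂ (c₂≤u , u≤c₁))) c₂≤q q≤c₁))
    ; balanced = trans (shift (h c₁)) (ℤ.+-inverseʳ (h c₁))
    }
    where
    regroup : ∀ t₁ t₂ e₁ e₂ z → (t₂ - t₁) + (z - e₂) ≡ (z - e₁) + ((e₁ - t₁) - (e₂ - t₂))
    regroup = solve-∀
    shift : ∀ z → (h τ₂ - h τ₁) + (z - h c₂) ≡ z - h c₁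
    shift z = trans (regroup (h τ₁) (h τ₂) (h c₁) (h c₂) z)
                (trans (cong (λ s → (z - h c₁) + (s - (h c₂ - h τ₂))) same-gap)
                  (trans (cong ((z - h c₁) +_) (ℤ.+-inverseʳ (h c₂ - h τ₂))) (ℤ.+-identityʳ _)))
    c₂<c₁ : c₂ ℕ.< c₁
    c₂<c₁ with ℕ.<-cmp c₁ c₂
    ... | tri< c₁<c₂ _ _ = ⊥-elim (ℤ.<⇒≱ (ℤ.<-trans (drops e₁) lower)
                                          (above e₂ (suc c₁) (ℕ.m≤n⇒m≤1+n τ₂≤c₁) c₁<c₂))
    ... | tri≈ _ refl _ = ⊥-elim (ℤ.<-irrefl (cancel (h c₁) same-gap) lower)
      where
      cancel : ∀ z {x y} → z - x ≡ z - y → x ≡ y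
      cancel z {x} {y} eq = trans (twice-neg z x) (trans (cong (z -_) eq) (sym (twice-neg z y)))
        where
        twice-neg : ∀ z x → x ≡ z - (z - x)
        twice-neg = solve-∀
    ... | tri> _ _ c₂<c₁ = c₂<c₁

  private
    collision-≤ : ∀ {τ₁ τ₂ c₁ c₂} → τ₁ ≢ τ₂ → AtUpStep h τ₁ → AtUpStep h τ₂ →
                  FirstExit h τ₁ c₁ → FirstExit h τ₂ c₂ → c₁ ℕ.< t → c₂ ℕ.< t →
                  FallsBetween h c₁ c₂ → h c₁ - h τ₁ ≡ h c₂ - h τ₂ → h τ₁ ≤ h τ₂ → Splitting h t
    collision-≤ {τ₁} {τ₂} τ₁≢τ₂ up₁ up₂ e₁ e₂ c₁<t c₂<t falls same-gap le with ℕ.<-cmp τ₁ τ₂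
    ... | tri≈ _ τ₁≡τ₂ _ = ⊥-elim (τ₁≢τ₂ τ₁≡τ₂)
    ... | tri< τ₁<τ₂ _ _ with upStep≤exit h up₂ (τ≤c e₂) falls | h τ₁ ℤ.≟ h τ₂
    ...   | τ₂≤c₁ | yes level = excursion⇒splitting τ₁ τ₂ τ₁<τ₂ (ℕ.≤-trans τ₂≤c₁ (ℕ.<⇒≤ c₁<t))
                                   (inj₁ (upStep⇒≥1 h up₁))
                                   (λ q τ₁≤q q≤τ₂ → above e₁ q τ₁≤q (ℕ.≤-trans q≤τ₂ τ₂≤c₁)) level
    ...   | τ₂≤c₁ | no  lower = nestedExits⇒splitting e₁ e₂ (upStep⇒≥1 h up₁) τ₁<τ₂ τ₂≤c₁ c₁<t
                                   (ℤ.≤∧≢⇒< le lower) falls same-gap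
    collision-≤ {τ₁} {τ₂} {c₁} {c₂} _ up₁ up₂ e₁ e₂ _ c₂<t falls _ le | tri> _ _ τ₂<τ₁ =
      excursion⇒splitting τ₂ τ₁ τ₂<τ₁ (ℕ.≤-trans τ₁≤c₂ (ℕ.<⇒≤ c₂<t)) (inj₁ (upStep⇒≥1 h up₂))
        (λ q τ₂≤q q≤τ₁ → above e₂ q τ₂≤q (ℕ.≤-trans q≤τ₁ τ₁≤c₂))
        (ℤ.≤-antisym (above e₂ τ₁ (ℕ.<⇒≤ τ₂<τ₁) τ₁≤c₂) le)
      where
      τ₁≤c₂ : τ₁ ℕ.≤ c₂
      τ₁≤c₂ = upStep≤exit h up₁ (τ≤c e₁) (λ u b → falls u (between-sym b))

  collision⇒splitting : ∀ {τ₁ τ₂ c₁ c₂} → τ₁ ≢ τ₂ → AtUpStep h τ₁ → AtUpStep h τ₂ →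
                        FirstExit h τ₁ c₁ → FirstExit h τ₂ c₂ → c₁ ℕ.< t → c₂ ℕ.< t →
                        FallsBetween h c₁ c₂ → h c₁ - h τ₁ ≡ h c₂ - h τ₂ → Splitting h t
  collision⇒splitting {τ₁} {τ₂} τ₁≢τ₂ up₁ up₂ e₁ e₂ c₁<t c₂<t falls same-gap with h τ₁ ℤ.≤? h τ₂
  ... | yes le = collision-≤ τ₁≢τ₂ up₁ up₂ e₁ e₂ c₁<t c₂<t falls same-gap le
  ... | no  ≰  = collision-≤ (≢-sym τ₁≢τ₂) up₂ up₁ e₂ e₁ c₂<t c₁<t (λ u b → falls u (between-sym b))
                   (sym same-gap) (ℤ.<⇒≤ (ℤ.≰⇒> ≰))

mirror-≤ : ∀ {t j k q} → j ℕ.≤ t → k ℕ.≤ t → t ∸ k ℕ.≤ q → q ℕ.≤ t ∸ j →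
           j ℕ.≤ t ∸ q × t ∸ q ℕ.≤ k
mirror-≤ {t} {j} {k} {q} j≤t k≤t t∸k≤q q≤t∸j =
  ℕ.m+n≤o⇒m≤o∸n j (subst (ℕ._≤ t) (ℕ.+-comm q j) (ℕ.m≤o∸n⇒m+n≤o q j≤t q≤t∸j)) ,
  subst (t ∸ q ℕ.≤_) (ℕ.m∸[m∸n]≡n k≤t) (ℕ.∸-monoʳ-≤ t t∸k≤q)

splitting-reverse : ∀ h t → Splitting (λ q → h (t ∸ q)) t → Splitting h t
splitting-reverse h t s = record
  { a = t ∸ d′ ; b = t ∸ c′ ; c = t ∸ b′ ; d = t ∸ a′
  ; a≤b = ℕ.∸-monoʳ-≤ t c≤d ; b≤c = ℕ.∸-monoʳ-≤ t b≤c
  ; c≤d = ℕ.∸-monoʳ-≤ t a≤b ; d≤t = ℕ.m∸n≤m t a′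
  ; inner-nonempty = inner
  ; outer-nonempty = outer
  ; B-above  = λ q A≤q q≤B → let (c′≤ , ≤d′) = mirror-≤ c′≤t d≤t A≤q q≤B in
      subst (g d′ ≤_) (sym (unmirror q (ℕ.≤-trans q≤B (ℕ.m∸n≤m t c′))))
        (ℤ.0≤i-j⇒j≤i (subst (0ℤ ≤_) (through (g (t ∸ q))) (D-above (t ∸ q) c′≤ ≤d′)))
  ; C-above  = λ q B≤q q≤C → let (b′≤ , ≤c′) = mirror-≤ b′≤t c′≤t B≤q q≤C in
      subst₂ _≤_ (sym rise) (sym (unmirror q (ℕ.≤-trans q≤C (ℕ.m∸n≤m t b′)))) (C-above (t ∸ q) b′≤ ≤c′)
  ; D-above  = λ q C≤q q≤D → let (a′≤ , ≤b′) = mirror-≤ a′≤t b′≤t C≤q q≤D in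
      subst (λ x → 0ℤ ≤ (g c′ - g d′) + (x - g b′)) (sym (unmirror q (ℕ.≤-trans q≤D (ℕ.m∸n≤m t a′))))
        (subst (0ℤ ≤_) (sym (trans (cong (_+ (g (t ∸ q) - g b′)) rise) (telescope (g a′) (g b′) (g (t ∸ q)))))
          (ℤ.i≤j⇒0≤j-i (B-above (t ∸ q) a′≤ ≤b′)))
  ; balanced = trans (cong (_+ (g a′ - g b′)) rise) (cancel (g a′) (g b′))
  }
  where
  open Splitting s renaming (a to a′; b to b′; c to c′; d to d′)
  g : ℕ → ℤ
  g q = h (t ∸ q)
  c′≤t = ℕ.≤-trans c≤d d≤t
  b′≤t = ℕ.≤-trans b≤c c′≤t
  a′≤t = ℕ.≤-trans a≤b b′≤t

  unmirror : ∀ q → q ℕ.≤ t → h q ≡ g (t ∸ q)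
  unmirror q q≤t = cong h (sym (ℕ.m∸[m∸n]≡n q≤t))

  telescope : ∀ x y z → (y - x) + (z - y) ≡ z - x
  telescope = solve-∀
  cancel : ∀ x y → (y - x) + (x - y) ≡ 0ℤ
  cancel = solve-∀

  rise : g c′ - g d′ ≡ g b′ - g a′
  rise = trans (rearrange (g b′ - g a′) (g c′) (g d′)) (trans (cong (g b′ - g a′ -_) balanced) (ℤ.+-identityʳ _))
    where
    rearrange : ∀ r x y → x - y ≡ r - (r + (y - x))
    rearrange = solve-∀

  through : ∀ x → (g b′ - g a′) + (x - g c′) ≡ x - g d′
  through x = trans (cong (_+ (x - g c′)) (sym rise)) (telescope (g d′) (g c′) x)

  inner : t ∸ d′ ℕ.< t ∸ c′ ⊎ t ∸ b′ ℕ.< t ∸ a′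
  inner with inner-nonempty
  ... | inj₁ a′<b′ = inj₂ (ℕ.∸-monoʳ-< a′<b′ b′≤t)
  ... | inj₂ c′<d′ = inj₁ (ℕ.∸-monoʳ-< c′<d′ d≤t)

  outer : 1 ℕ.≤ t ∸ d′ ⊎ t ∸ a′ ℕ.< t
  outer with outer-nonempty
  ... | inj₁ 1≤a′ = inj₂ (ℕ.∸-monoʳ-< {o = 0} 1≤a′ a′≤t)
  ... | inj₂ d′<t = inj₁ (ℕ.m<n⇒0<n∸m d′<t)

runTailMax : ℤ → List ℤ → ℕ
runTailMax x []       = 0
runTailMax x (z ∷ zs) = if sameSign x z then ∣ z ∣ ⊔ runTailMax z zs else 0

headRunMax : List ℤ → ℕ
headRunMax []       = 0
headRunMax (z ∷ zs) = ∣ z ∣ ⊔ runTailMax z zs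

runs-∷ : ∀ z zs → ∃₂ λ r rs → runs (z ∷ zs) ≡ (z ∷ r) ∷ rs × maxAbs (z ∷ r) ≡ headRunMax (z ∷ zs)
runs-∷ z []       = [] , [] , refl , refl
runs-∷ z (w ∷ ws) with runs-∷ w ws
... | r , rs , eq , max with sameSign z w in same
... | true  = w ∷ r , rs , go , cong (∣ z ∣ ⊔_) max
  where
  go : runs (z ∷ w ∷ ws) ≡ (z ∷ w ∷ r) ∷ rs
  go rewrite eq | same = refl
... | false = [] , (w ∷ r) ∷ rs , go , refl
  where
  go : runs (z ∷ w ∷ ws) ≡ (z ∷ []) ∷ (w ∷ r) ∷ rs
  go rewrite eq | same = refl

-- If x extends the first run of ys, the charge of that run grows from runTailMax x ys
-- to ∣ x ∣ ⊔ runTailMax x ys; otherwise runTailMax x ys = 0 and x is a run of its own.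
cost-∷ : ∀ x ys → cost (x ∷ ys) ℕ.+ runTailMax x ys ≡ cost ys ℕ.+ (∣ x ∣ ⊔ runTailMax x ys)
cost-∷ x []       = trans (ℕ.+-identityʳ _) (ℕ.+-identityʳ _)
cost-∷ x (w ∷ ws) with runs-∷ w ws
... | r , rs , eq , max with sameSign x w in same
... | true  = begin
  cost (x ∷ w ∷ ws) ℕ.+ M        ≡⟨ cong (ℕ._+ M) go-x ⟩
  (∣ x ∣ ⊔ M) ℕ.+ S ℕ.+ M        ≡⟨ swap (∣ x ∣ ⊔ M) S M ⟩
  (M ℕ.+ S) ℕ.+ (∣ x ∣ ⊔ M)      ≡⟨ cong (ℕ._+ (∣ x ∣ ⊔ M)) go-w ⟨
  cost (w ∷ ws) ℕ.+ (∣ x ∣ ⊔ M)  ∎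
  where
  open ≡-Reasoning
  M = ∣ w ∣ ⊔ runTailMax w ws
  S = sum (map maxAbs rs)
  swap : ∀ a b c → a ℕ.+ b ℕ.+ c ≡ (c ℕ.+ b) ℕ.+ a
  swap = ℕ-Solver.solve-∀
  go-x : cost (x ∷ w ∷ ws) ≡ (∣ x ∣ ⊔ M) ℕ.+ S
  go-x rewrite eq | same = cong (λ m → (∣ x ∣ ⊔ m) ℕ.+ S) max
  go-w : cost (w ∷ ws) ≡ M ℕ.+ S
  go-w rewrite eq = cong (ℕ._+ S) max
... | false = begin
  cost (x ∷ w ∷ ws) ℕ.+ 0        ≡⟨ ℕ.+-identityʳ _ ⟩
  cost (x ∷ w ∷ ws)              ≡⟨ go-x ⟩
  (∣ x ∣ ⊔ 0) ℕ.+ cost (w ∷ ws)  ≡⟨ ℕ.+-comm (∣ x ∣ ⊔ 0) _ ⟩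
  cost (w ∷ ws) ℕ.+ (∣ x ∣ ⊔ 0)  ∎
  where
  open ≡-Reasoning
  go-x : cost (x ∷ w ∷ ws) ≡ (∣ x ∣ ⊔ 0) ℕ.+ cost (w ∷ ws)
  go-x rewrite eq | same = refl

runTailMax≤headRunMax : ∀ x ys → runTailMax x ys ℕ.≤ headRunMax ys
runTailMax≤headRunMax x []       = z≤n
runTailMax≤headRunMax x (w ∷ ws) with sameSign x w
... | true  = ℕ.≤-refl
... | false = z≤n

head≤headRunMax : ∀ ys → ∣ entry ys 0 ∣ ℕ.≤ headRunMax ys
head≤headRunMax []       = z≤n
head≤headRunMax (z ∷ zs) = ℕ.m≤m⊔n ∣ z ∣ (runTailMax z zs)

cost-∷-≤ : ∀ x ys → cost ys ℕ.≤ cost (x ∷ ys)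
cost-∷-≤ x ys = ℕ.+-cancelʳ-≤ (runTailMax x ys) (cost ys) (cost (x ∷ ys))
  (ℕ.≤-trans (ℕ.+-monoʳ-≤ (cost ys) (ℕ.m≤n⊔m ∣ x ∣ (runTailMax x ys))) (ℕ.≤-reflexive (sym (cost-∷ x ys))))

cost-drop-≤ : ∀ j ys → cost (drop j ys) ℕ.≤ cost ys
cost-drop-≤ zero    ys       = ℕ.≤-refl
cost-drop-≤ (suc j) []       = ℕ.≤-refl
cost-drop-≤ (suc j) (x ∷ ys) = ℕ.≤-trans (cost-drop-≤ j ys) (cost-∷-≤ x ys)

-- Level s of the first run of ys is charged to the last entry x of that run with
-- ∣ x ∣ > s, inside the part cost (x ∷ rest) - cost rest of the cost that x adds.
runCode : List ℤ → ℕ → ℕ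
runCode []       s = 0
runCode (x ∷ ys) s with s ℕ.<? runTailMax x ys
... | yes _ = runCode ys s
... | no  _ = (s ∸ runTailMax x ys) ℕ.+ cost ys

runCode-< : ∀ ys s → s ℕ.< headRunMax ys → runCode ys s ℕ.< cost ys
runCode-< (x ∷ ys) s s<max with s ℕ.<? runTailMax x ys
... | yes s<tail = ℕ.<-≤-trans (runCode-< ys s (ℕ.<-≤-trans s<tail (runTailMax≤headRunMax x ys))) (cost-∷-≤ x ys)
... | no  s≮tail = ℕ.+-cancelʳ-< m _ _ (begin-strict
  (s ∸ m) ℕ.+ cost ys ℕ.+ m  ≡⟨ shuffle ⟩
  cost ys ℕ.+ s              <⟨ ℕ.+-monoʳ-< (cost ys) s<max ⟩
  cost ys ℕ.+ (∣ x ∣ ⊔ m)    ≡⟨ cost-∷ x ys ⟨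
  cost (x ∷ ys) ℕ.+ m        ∎)
  where
  open ℕ.≤-Reasoning
  m = runTailMax x ys
  regroup : ∀ a b c → a ℕ.+ b ℕ.+ c ≡ b ℕ.+ (a ℕ.+ c)
  regroup = ℕ-Solver.solve-∀
  shuffle : (s ∸ m) ℕ.+ cost ys ℕ.+ m ≡ cost ys ℕ.+ s
  shuffle = trans (regroup (s ∸ m) (cost ys) m) (cong (cost ys ℕ.+_) (ℕ.m∸n+n≡m (ℕ.≮⇒≥ s≮tail)))

runCode-injective : ∀ ys {s s′} → s ℕ.< headRunMax ys → s′ ℕ.< headRunMax ys →
                    runCode ys s ≡ runCode ys s′ → s ≡ s′
runCode-injective (x ∷ ys) {s} {s′} s< s′< eq with s ℕ.<? runTailMax x ys | s′ ℕ.<? runTailMax x ys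
... | yes s<m | yes s′<m = runCode-injective ys (ℕ.<-≤-trans s<m (runTailMax≤headRunMax x ys))
                             (ℕ.<-≤-trans s′<m (runTailMax≤headRunMax x ys)) eq
... | no  s≮m | no  s′≮m = begin
  s                    ≡⟨ ℕ.m∸n+n≡m (ℕ.≮⇒≥ s≮m) ⟨
  (s ∸ m) ℕ.+ m        ≡⟨ cong (ℕ._+ m) (ℕ.+-cancelʳ-≡ (cost ys) _ _ eq) ⟩
  (s′ ∸ m) ℕ.+ m       ≡⟨ ℕ.m∸n+n≡m (ℕ.≮⇒≥ s′≮m) ⟩
  s′                   ∎
  where
  open ≡-Reasoning
  m = runTailMax x ys
... | yes s<m | no  _    = ⊥-elim (ℕ.<⇒≱ (runCode-< ys s (ℕ.<-≤-trans s<m (runTailMax≤headRunMax x ys)))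
                                        (ℕ.≤-trans (ℕ.m≤n+m (cost ys) _) (ℕ.≤-reflexive (sym eq))))
... | no  _   | yes s′<m = ⊥-elim (ℕ.<⇒≱ (runCode-< ys s′ (ℕ.<-≤-trans s′<m (runTailMax≤headRunMax x ys)))
                                        (ℕ.≤-trans (ℕ.m≤n+m (cost ys) _) (ℕ.≤-reflexive eq)))

SameRun : ℕ → List ℤ → Set
SameRun zero    _            = ⊤
SameRun (suc j) (x ∷ z ∷ zs) = sameSign x z ≡ true × SameRun j (z ∷ zs)
SameRun (suc j) _            = ⊤

runTailMax-continues : ∀ x ys → 0 ℕ.< runTailMax x ys → ∃₂ λ w ws → ys ≡ w ∷ ws × sameSign x w ≡ true
runTailMax-continues x []       ()
runTailMax-continues x (w ∷ ws) 0<m with sameSign x w in same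
... | true = w , ws , refl , same
runTailMax-continues x (w ∷ ws) () | false

runCode-drop : ∀ j ys {s s′} → s ℕ.< headRunMax ys → s′ ℕ.< ∣ entry (drop j ys) 0 ∣ →
               runCode ys s ≡ runCode (drop j ys) s′ → s ≡ s′ × SameRun j ys
runCode-drop zero    ys       s< s′< eq = runCode-injective ys s< (ℕ.<-≤-trans s′< (head≤headRunMax ys)) eq , tt
runCode-drop (suc j) []       s< ()  eq
runCode-drop (suc j) (x ∷ ys) {s} {s′} s< s′< eq with s ℕ.<? runTailMax x ys
... | no  _   = ⊥-elim (ℕ.<⇒≱ (ℕ.<-≤-trans
                  (runCode-< (drop j ys) s′ (ℕ.<-≤-trans s′< (head≤headRunMax (drop j ys))))
                  (ℕ.≤-trans (cost-drop-≤ j ys) (ℕ.m≤n+m (cost ys) _)))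
                  (ℕ.≤-reflexive eq))
... | yes s<m with runTailMax-continues x ys (ℕ.≤-<-trans z≤n s<m)
...   | w , ws , refl , same with runCode-drop j (w ∷ ws) (ℕ.<-≤-trans s<m (runTailMax≤headRunMax x (w ∷ ws))) s′< eq
...     | s≡s′ , run = s≡s′ , same , run

isPos-pos : ∀ {z} → 0ℤ < z → isPos z ≡ true
isPos-pos {z} 0<z = trans (isYes≗does (0ℤ ℤ.<? z)) (dec-true (0ℤ ℤ.<? z) 0<z)

isPos-neg : ∀ {z} → z < 0ℤ → isPos z ≡ false
isPos-neg {z} z<0 = trans (isYes≗does (0ℤ ℤ.<? z)) (dec-false (0ℤ ℤ.<? z) (ℤ.<-asym z<0))

isPos-true : ∀ {z} → isPos z ≡ true → 0ℤ < z
isPos-true pos = toWitness (subst T (sym pos) tt)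

isPos-false : ∀ {z} → z ≢ 0ℤ → isPos z ≡ false → z < 0ℤ
isPos-false z≢0 ¬pos = ℤ.≤∧≢⇒< (ℤ.≮⇒≥ (toWitnessFalse (subst (T ∘ not) (sym ¬pos) tt))) z≢0

not-xor-≡ : ∀ {a b : Bool} → not (a xor b) ≡ true → a ≡ b
not-xor-≡ {true}  {true}  _ = refl
not-xor-≡ {false} {false} _ = refl

≡-not-xor : ∀ {a b : Bool} → a ≡ b → not (a xor b) ≡ true
≡-not-xor {true}  refl = refl
≡-not-xor {false} refl = refl

length-runs-same : ∀ {z w} ws → sameSign z w ≡ true → length (runs (z ∷ w ∷ ws)) ≡ length (runs (w ∷ ws))
length-runs-same {z} {w} ws same with runs-∷ w ws
... | r , rs , eq , _ rewrite eq | same = refl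

length-runs-differ : ∀ {z w} ws → sameSign z w ≡ false → length (runs (z ∷ w ∷ ws)) ≡ suc (length (runs (w ∷ ws)))
length-runs-differ {z} {w} ws differ with runs-∷ w ws
... | r , rs , eq , _ rewrite eq | differ = refl

allNeg-runs : ∀ {zs} → All (_< 0ℤ) zs → length (runs zs) ℕ.≤ 1
allNeg-runs []                          = z≤n
allNeg-runs (_ ∷ [])                    = s≤s z≤n
allNeg-runs {z ∷ w ∷ ws} (z<0 ∷ ws<0@(w<0 ∷ _)) =
  subst (ℕ._≤ 1) (sym (length-runs-same ws (≡-not-xor (trans (isPos-neg z<0) (sym (isPos-neg w<0))))))
    (allNeg-runs ws<0)

data PosThenNeg : List ℤ → Set where
  negs : ∀ {zs} → All (_< 0ℤ) zs → PosThenNeg zs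
  pos  : ∀ {z zs} → 0ℤ < z → PosThenNeg zs → PosThenNeg (z ∷ zs)

posThenNeg-runs : ∀ {zs} → PosThenNeg zs → length (runs zs) ℕ.≤ 2
posThenNeg-runs (negs zs<0)                  = ℕ.m≤n⇒m≤1+n (allNeg-runs zs<0)
posThenNeg-runs (pos _ (negs []))            = s≤s z≤n
posThenNeg-runs {z ∷ w ∷ ws} (pos 0<z (negs ws<0@(w<0 ∷ _))) =
  subst (ℕ._≤ 2) (sym (length-runs-differ ws (cong₂ (λ a b → not (a xor b)) (isPos-pos 0<z) (isPos-neg w<0))))
    (s≤s (allNeg-runs ws<0))
posThenNeg-runs {z ∷ w ∷ ws} (pos 0<z rest@(pos 0<w _)) =
  subst (ℕ._≤ 2) (sym (length-runs-same ws (≡-not-xor (trans (isPos-pos 0<z) (sym (isPos-pos 0<w))))))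
    (posThenNeg-runs rest)

record Valley (xs : List ℤ) : Set where
  field
    p      : ℕ
    p+1<t  : suc p ℕ.< length xs
    falls  : entry xs p < 0ℤ
    rises  : 0ℤ < entry xs (suc p)

valley-or-posThenNeg : ∀ xs → All (_≢ 0ℤ) xs → Valley xs ⊎ PosThenNeg xs
valley-or-posThenNeg []       []          = inj₂ (negs [])
valley-or-posThenNeg (x ∷ xs) (x≢0 ∷ xs≢0) with valley-or-posThenNeg xs xs≢0
... | inj₁ v = inj₁ (record { p = suc p ; p+1<t = s≤s p+1<t ; falls = falls ; rises = rises })
  where open Valley v
... | inj₂ rest with ℤ.<-cmp x 0ℤ | rest
...   | tri≈ _ x≡0 _ | _              = ⊥-elim (x≢0 x≡0)
...   | tri> _ _ 0<x | _              = inj₂ (pos 0<x rest)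
...   | tri< x<0 _ _ | negs xs<0      = inj₂ (negs (x<0 ∷ xs<0))
...   | tri< x<0 _ _ | pos 0<x′ _     = inj₁ (record { p = 0 ; p+1<t = s≤s (s≤s z≤n) ; falls = x<0 ; rises = 0<x′ })

entry-drop : ∀ xs c k → entry (drop c xs) k ≡ entry xs (c ℕ.+ k)
entry-drop xs       zero    k = refl
entry-drop []       (suc c) k = refl
entry-drop (x ∷ xs) (suc c) k = entry-drop xs c k

entry-drop-head : ∀ xs c → entry (drop c xs) 0 ≡ entry xs c
entry-drop-head xs c = trans (entry-drop xs c 0) (cong (entry xs) (ℕ.+-identityʳ c))

entry≢0 : ∀ {xs} → All (_≢ 0ℤ) xs → ∀ {u} → u ℕ.< length xs → entry xs u ≢ 0ℤ
entry≢0 (x≢0 ∷ _)    {zero}  _         = x≢0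
entry≢0 (_ ∷ xs≢0)   {suc u} (s≤s u<t) = entry≢0 xs≢0 u<t

sameRun-sign : ∀ j ys → SameRun j ys → ∀ {k} → k ℕ.≤ j → k ℕ.< length ys → isPos (entry ys k) ≡ isPos (entry ys 0)
sameRun-sign j       ys           _            {zero}  _         _              = refl
sameRun-sign (suc j) (x ∷ z ∷ zs) (same , run) {suc k} (s≤s k≤j) (s≤s k<length) =
  trans (sameRun-sign j (z ∷ zs) run k≤j k<length) (sym (not-xor-≡ same))

runCode-collision-≤ : ∀ xs {st₁ st₂ s₁ s₂} → st₁ ℕ.≤ st₂ → st₂ ℕ.< length xs →
                      s₁ ℕ.< ∣ entry xs st₁ ∣ → s₂ ℕ.< ∣ entry xs st₂ ∣ →
                      runCode (drop st₁ xs) s₁ ≡ runCode (drop st₂ xs) s₂ →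
                      s₁ ≡ s₂ × (∀ u → st₁ ℕ.≤ u → u ℕ.≤ st₂ → isPos (entry xs u) ≡ isPos (entry xs st₁))
runCode-collision-≤ xs {st₁} {s₁ = s₁} {s₂} st₁≤st₂ st₂<t s₁< s₂< eq with ℕ.m≤n⇒∃[o]m+o≡n st₁≤st₂
... | j , refl with runCode-drop j (drop st₁ xs)
                      (ℕ.<-≤-trans (subst (λ z → s₁ ℕ.< ∣ z ∣) (sym (entry-drop-head xs st₁)) s₁<)
                                   (head≤headRunMax (drop st₁ xs)))
                      (subst (λ z → s₂ ℕ.< ∣ entry z 0 ∣) (sym (List.drop-drop st₁ j xs))
                         (subst (λ z → s₂ ℕ.< ∣ z ∣) (sym (entry-drop-head xs (st₁ ℕ.+ j))) s₂<))
                      (trans eq (cong (λ z → runCode z s₂) (sym (List.drop-drop st₁ j xs))))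
...   | s₁≡s₂ , run = s₁≡s₂ , sign
  where
  sign : ∀ u → st₁ ℕ.≤ u → u ℕ.≤ st₁ ℕ.+ j → isPos (entry xs u) ≡ isPos (entry xs st₁)
  sign u st₁≤u u≤ = subst₂ (λ a b → isPos a ≡ isPos b)
    (trans (entry-drop xs st₁ (u ∸ st₁)) (cong (entry xs) (ℕ.m+[n∸m]≡n st₁≤u)))
    (entry-drop-head xs st₁)
    (sameRun-sign j (drop st₁ xs) run (ℕ.m≤n+o⇒m∸n≤o u st₁ u≤)
       (subst ((u ∸ st₁) ℕ.<_) (sym (List.length-drop st₁ xs)) (ℕ.∸-monoˡ-< (ℕ.≤-<-trans u≤ st₂<t) st₁≤u)))

runCode-collision : ∀ xs {st₁ st₂ s₁ s₂} → st₁ ℕ.< length xs → st₂ ℕ.< length xs →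
                    s₁ ℕ.< ∣ entry xs st₁ ∣ → s₂ ℕ.< ∣ entry xs st₂ ∣ →
                    runCode (drop st₁ xs) s₁ ≡ runCode (drop st₂ xs) s₂ →
                    s₁ ≡ s₂ × (∀ u → Between st₁ st₂ u → isPos (entry xs u) ≡ isPos (entry xs st₁))
runCode-collision xs {st₁} {st₂} st₁<t st₂<t s₁< s₂< eq with ℕ.≤-total st₁ st₂
... | inj₁ st₁≤st₂ with runCode-collision-≤ xs st₁≤st₂ st₂<t s₁< s₂< eq
...   | s₁≡s₂ , sign = s₁≡s₂ , sign′
  where
  sign′ : ∀ u → Between st₁ st₂ u → isPos (entry xs u) ≡ isPos (entry xs st₁)
  sign′ u (inj₁ (st₁≤u , u≤st₂)) = sign u st₁≤u u≤st₂
  sign′ u (inj₂ (st₂≤u , u≤st₁)) = sign u (ℕ.≤-trans st₁≤st₂ st₂≤u) (ℕ.≤-trans u≤st₁ st₁≤st₂)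
runCode-collision xs {st₁} {st₂} st₁<t st₂<t s₁< s₂< eq | inj₂ st₂≤st₁
  with runCode-collision-≤ xs st₂≤st₁ st₁<t s₂< s₁< (sym eq)
... | s₂≡s₁ , sign = sym s₂≡s₁ , sign′
  where
  sign′ : ∀ u → Between st₁ st₂ u → isPos (entry xs u) ≡ isPos (entry xs st₁)
  sign′ u (inj₂ (st₂≤u , u≤st₁)) = trans (sign u st₂≤u u≤st₁) (sym (sign st₁ st₂≤st₁ ℕ.≤-refl))
  sign′ u (inj₁ (st₁≤u , u≤st₂)) = trans (sign u (ℕ.≤-trans st₂≤st₁ st₁≤u) (ℕ.≤-trans u≤st₂ st₂≤st₁))
                                         (sym (sign st₁ st₂≤st₁ ℕ.≤-refl))

returnToZero⇒reducible : ∀ {xs e} → GenCatalan xs → 0 ℕ.< e → e ℕ.< length xs → height xs e ≡ 0ℤ → Reducible xs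
returnToZero⇒reducible {xs} {e} gc 0<e e<t he≡0 =
  splitting⇒reducible xs nonneg (GenCatalan.sumZero gc)
    (excursion⇒splitting (height xs) (length xs) nonneg 0 e 0<e (ℕ.<⇒≤ e<t) (inj₂ e<t)
      (λ q _ _ → nonneg q) (sym he≡0))
  where nonneg = genCatalan-height-nonneg gc

module _ {xs : List ℤ} (xs≢0 : All (_≢ 0ℤ) xs) (gc : GenCatalan xs) (cost≡width : cost xs ≡ length xs)
         (v : Valley xs) (peak : 0ℤ < height xs (suc (Valley.p v))) where

  private
    t = length xs
    h = height xs
    nonneg = genCatalan-height-nonneg gc
    e = suc (Valley.p v)

    h′ : ℕ → ℤ
    h′ q = h (t ∸ q)

    nonneg′ : ∀ q → 0ℤ ≤ h′ q
    nonneg′ q = nonneg (t ∸ q)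

    t∸u≡1+t∸1+u : ∀ {u} → u ℕ.< t → t ∸ u ≡ suc (t ∸ suc u)
    t∸u≡1+t∸1+u u<t = ℕ.+-∸-assoc 1 u<t

    record MarkedExit (g : ℕ → ℤ) : Set where
      field
        τ c  : ℕ
        up   : AtUpStep g τ
        exit : FirstExit g τ c
        c<t  : c ℕ.< t

      gap : ℕ
      gap = ∣ g c - g τ ∣

      height-τ≤c : g τ ≤ g c
      height-τ≤c = FirstExit.above exit c (FirstExit.τ≤c exit) ℕ.≤-refl

      gap-<-step : gap ℕ.< ∣ g c - g (suc c) ∣
      gap-<-step = gap-< (FirstExit.drops exit) height-τ≤c

    open MarkedExit

    gap-injective : ∀ {g} (m₁ m₂ : MarkedExit g) → gap m₁ ≡ gap m₂ → g (c m₁) - g (τ m₁) ≡ g (c m₂) - g (τ m₂)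
    gap-injective m₁ m₂ eq = trans (sym (ℤ.0≤i⇒+∣i∣≡i (ℤ.i≤j⇒0≤j-i (height-τ≤c m₁))))
                               (trans (cong ℤ.+_ eq) (ℤ.0≤i⇒+∣i∣≡i (ℤ.i≤j⇒0≤j-i (height-τ≤c m₂))))

    markedExit : ∀ g {τ} → AtUpStep g τ → τ ℕ.≤ t → g t < g τ → MarkedExit g
    markedExit g up τ≤t below =
      let (c , exit , c<t) = firstExit g τ≤t below in record { τ = _ ; c = c ; up = up ; exit = exit ; c<t = c<t }

    upExit-falls : (m : MarkedExit h) → entry xs (c m) < 0ℤ
    upExit-falls m = falls⇒entry-neg xs (ℤ.<-≤-trans (FirstExit.drops (exit m)) (height-τ≤c m))

    upExit-gap : (m : MarkedExit h) → gap m ℕ.< ∣ entry xs (c m) ∣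
    upExit-gap m = subst (gap m ℕ.<_)
      (trans (ℤ.∣i-j∣≡∣j-i∣ (h (c m)) (h (suc (c m)))) (sym (∣entry∣≡∣height-diff∣ xs (c m))))
      (gap-<-step m)

    downStep : MarkedExit h′ → ℕ
    downStep m = t ∸ suc (c m)

    downStep<t : (m : MarkedExit h′) → downStep m ℕ.< t
    downStep<t m = ℕ.∸-monoʳ-< {o = 0} (s≤s z≤n) (c<t m)

    h′-c : (m : MarkedExit h′) → h′ (c m) ≡ h (suc (downStep m))
    h′-c m = cong h (t∸u≡1+t∸1+u (c<t m))

    downExit-rises : (m : MarkedExit h′) → 0ℤ < entry xs (downStep m)
    downExit-rises m = rises⇒entry-pos xs
      (subst (h (downStep m) <_) (h′-c m) (ℤ.<-≤-trans (FirstExit.drops (exit m)) (height-τ≤c m)))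

    downExit-gap : (m : MarkedExit h′) → gap m ℕ.< ∣ entry xs (downStep m) ∣
    downExit-gap m = subst (gap m ℕ.<_)
      (trans (cong (λ z → ∣ z - h (downStep m) ∣) (h′-c m)) (sym (∣entry∣≡∣height-diff∣ xs (downStep m))))
      (gap-<-step m)

    h′-mirror : ∀ {q} → q ℕ.≤ t → h′ (t ∸ q) ≡ h q
    h′-mirror q≤t = cong h (ℕ.m∸[m∸n]≡n q≤t)

    -- The items u ≤ t: an up-step x_u > 0 climbs to τ = u + 1, the index u = t stands
    -- for the rise after the valley, and a down-step x_u < 0 climbs on the reversed path.
    UpItem : ℕ → Set
    UpItem u = Σ[ m ∈ MarkedExit h ] (τ m ≡ suc u × 0ℤ < entry xs u ⊎ u ≡ t × τ m ≡ e)

    DownItem : ℕ → Set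
    DownItem u = Σ[ m ∈ MarkedExit h′ ] (τ m ≡ t ∸ u × u ℕ.< t)

    Item : ℕ → Set
    Item u = UpItem u ⊎ DownItem u

    item : ∀ u → u ℕ.< suc t → Item u
    item u u<1+t with u ℕ.<? t
    ... | no u≮t = inj₁ (markedExit h (inj₂ (height-rises xs (Valley.rises v))) (ℕ.<⇒≤ (Valley.p+1<t v))
                           (subst (_< h e) (sym (genCatalan-height-end gc)) peak) ,
                         inj₂ (ℕ.≤-antisym (ℕ.s≤s⁻¹ u<1+t) (ℕ.≮⇒≥ u≮t) , refl))
    ... | yes u<t with ℤ.<-cmp (entry xs u) 0ℤ
    ...   | tri≈ _ x≡0 _ = ⊥-elim (entry≢0 xs≢0 u<t x≡0)
    ...   | tri> _ _ 0<x = inj₁ (markedExit h (inj₁ (height-rises xs 0<x)) u<t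
                                   (subst (_< h (suc u)) (sym (genCatalan-height-end gc))
                                      (ℤ.≤-<-trans (nonneg u) (height-rises xs 0<x))) ,
                                 inj₁ (refl , 0<x))
    ...   | tri< x<0 _ _ = inj₂ (markedExit h′ rise (ℕ.m∸n≤m t u) below , refl , u<t)
      where
      rise : AtUpStep h′ (t ∸ u)
      rise = subst (AtUpStep h′) (sym (t∸u≡1+t∸1+u u<t))
             (inj₁ (subst₂ _<_ (sym (h′-mirror u<t))
                      (sym (trans (cong h′ (sym (t∸u≡1+t∸1+u u<t))) (h′-mirror (ℕ.<⇒≤ u<t))))
                      (height-falls xs x<0)))
      below : h′ t < h′ (t ∸ u)
      below = subst₂ _<_ (cong h (sym (ℕ.n∸n≡0 t))) (sym (h′-mirror (ℕ.<⇒≤ u<t)))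
                (ℤ.≤-<-trans (nonneg (suc u)) (height-falls xs x<0))

    step : ∀ {u} → Item u → ℕ
    step (inj₁ (m , _)) = c m
    step (inj₂ (m , _)) = downStep m

    itemGap : ∀ {u} → Item u → ℕ
    itemGap (inj₁ (m , _)) = gap m
    itemGap (inj₂ (m , _)) = gap m

    step<t : ∀ {u} (I : Item u) → step I ℕ.< t
    step<t (inj₁ (m , _)) = c<t m
    step<t (inj₂ (m , _)) = downStep<t m

    itemGap<entry : ∀ {u} (I : Item u) → itemGap I ℕ.< ∣ entry xs (step I) ∣
    itemGap<entry (inj₁ (m , _)) = upExit-gap m
    itemGap<entry (inj₂ (m , _)) = downExit-gap m

    code : ∀ {u} → Item u → ℕ
    code I = runCode (drop (step I) xs) (itemGap I)

    code<t : ∀ {u} (I : Item u) → code I ℕ.< t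
    code<t I = ℕ.<-≤-trans
      (runCode-< (drop (step I) xs) (itemGap I)
        (ℕ.<-≤-trans (subst (λ z → itemGap I ℕ.< ∣ z ∣) (sym (entry-drop-head xs (step I))) (itemGap<entry I))
                     (head≤headRunMax (drop (step I) xs))))
      (ℕ.≤-trans (cost-drop-≤ (step I) xs) (ℕ.≤-reflexive cost≡width))

    notValleyBottom : ∀ {w} → 0ℤ < entry xs w → suc w ≢ e
    notValleyBottom 0<x 1+w≡e = ℤ.<-asym (Valley.falls v) (subst (λ w → 0ℤ < entry xs w) (ℕ.suc-injective 1+w≡e) 0<x)

    upItem-τ-injective : ∀ {u₁ u₂} → u₁ ≢ u₂ → (I₁ : UpItem u₁) (I₂ : UpItem u₂) →
                         τ (proj₁ I₁) ≢ τ (proj₁ I₂)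
    upItem-τ-injective u₁≢u₂ (_ , inj₁ (τ₁≡ , _))   (_ , inj₁ (τ₂≡ , _))   τ≡ =
      u₁≢u₂ (ℕ.suc-injective (trans (sym τ₁≡) (trans τ≡ τ₂≡)))
    upItem-τ-injective u₁≢u₂ (_ , inj₂ (u₁≡t , _)) (_ , inj₂ (u₂≡t , _)) _  = u₁≢u₂ (trans u₁≡t (sym u₂≡t))
    upItem-τ-injective u₁≢u₂ (_ , inj₁ (τ₁≡ , 0<x)) (_ , inj₂ (_ , τ₂≡e)) τ≡ =
      notValleyBottom 0<x (trans (sym τ₁≡) (trans τ≡ τ₂≡e))
    upItem-τ-injective u₁≢u₂ (_ , inj₂ (_ , τ₁≡e)) (_ , inj₁ (τ₂≡ , 0<x)) τ≡ =
      notValleyBottom 0<x (trans (sym τ₂≡) (trans (sym τ≡) τ₁≡e))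

    downItem-τ-injective : ∀ {u₁ u₂} → u₁ ≢ u₂ → (I₁ : DownItem u₁) (I₂ : DownItem u₂) →
                           τ (proj₁ I₁) ≢ τ (proj₁ I₂)
    downItem-τ-injective u₁≢u₂ (_ , τ₁≡ , u₁<t) (_ , τ₂≡ , u₂<t) τ≡ =
      u₁≢u₂ (ℕ.∸-cancelˡ-≡ (ℕ.<⇒≤ u₁<t) (ℕ.<⇒≤ u₂<t) (trans (sym τ₁≡) (trans τ≡ τ₂≡)))

    collision : ∀ {u₁ u₂} → u₁ ≢ u₂ → (I₁ : Item u₁) (I₂ : Item u₂) → code I₁ ≡ code I₂ → Splitting h t
    collision u₁≢u₂ I₁ I₂ eq
      with runCode-collision xs (step<t I₁) (step<t I₂) (itemGap<entry I₁) (itemGap<entry I₂) eq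
    collision u₁≢u₂ (inj₁ I₁@(m₁ , _)) (inj₁ I₂@(m₂ , _)) eq | gap≡ , sign =
      collision⇒splitting h t nonneg (upItem-τ-injective u₁≢u₂ I₁ I₂) (up m₁) (up m₂) (exit m₁) (exit m₂)
        (c<t m₁) (c<t m₂) falls (gap-injective m₁ m₂ gap≡)
      where
      falls : FallsBetween h (c m₁) (c m₂)
      falls u between = height-falls xs (isPos-false (entry≢0 xs≢0 (between-< (c<t m₁) (c<t m₂) between))
                          (trans (sign u between) (isPos-neg (upExit-falls m₁))))
    collision u₁≢u₂ (inj₂ I₁@(m₁ , _)) (inj₂ I₂@(m₂ , _)) eq | gap≡ , sign =
      splitting-reverse h t (collision⇒splitting h′ t nonneg′ (downItem-τ-injective u₁≢u₂ I₁ I₂) (up m₁) (up m₂)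
        (exit m₁) (exit m₂) (c<t m₁) (c<t m₂) falls (gap-injective m₁ m₂ gap≡))
      where
      falls : FallsBetween h′ (c m₁) (c m₂)
      falls w between = subst (h (t ∸ suc w) <_) (cong h (sym (t∸u≡1+t∸1+u (between-< (c<t m₁) (c<t m₂) between))))
                          (height-rises xs (isPos-true (trans (sign (t ∸ suc w) (between-mirror t between))
                                                              (isPos-pos (downExit-rises m₁)))))
    collision _ (inj₁ (m₁ , _)) (inj₂ (m₂ , _)) _ | _ , sign =
      ⊥-elim (ℤ.<-asym (upExit-falls m₁)
        (isPos-true (trans (sym (sign (downStep m₂) (between-right _ _))) (isPos-pos (downExit-rises m₂)))))
    collision _ (inj₂ (m₁ , _)) (inj₁ (m₂ , _)) _ | _ , sign =
      ⊥-elim (ℤ.<-asym (upExit-falls m₂)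
        (isPos-true (trans (sign (c m₂) (between-right _ _)) (isPos-pos (downExit-rises m₁)))))

  valley⇒reducible : Reducible xs
  valley⇒reducible with Fin.pigeonhole (ℕ.n<1+n t) (λ i → fromℕ< (code<t (item (toℕ i) (Fin.toℕ<n i))))
  ... | i , j , i<j , eq = splitting⇒reducible xs nonneg (GenCatalan.sumZero gc)
    (collision (ℕ.<⇒≢ i<j) (item (toℕ i) (Fin.toℕ<n i)) (item (toℕ j) (Fin.toℕ<n j))
       (trans (sym (Fin.toℕ-fromℕ< _)) (trans (cong toℕ eq) (Fin.toℕ-fromℕ< _))))

theorem3p1 : (xs : List ℤ) (y : ℕ) → All (λ x → x ≢ 0ℤ) xs → GenCatalan xs →
    length (runs xs) ≡ 2 * y → cost xs ≡ width xs → 1 ℕ.< y → Reducible xs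
theorem3p1 xs y xs≢0 gc runs≡2y cost≡width 1<y with valley-or-posThenNeg xs xs≢0
... | inj₂ posThenNeg = ⊥-elim (ℕ.<⇒≱ more-than-two-runs (posThenNeg-runs posThenNeg))
  where
  more-than-two-runs : 2 ℕ.< length (runs xs)
  more-than-two-runs =
    ℕ.<-≤-trans (s≤s (s≤s (s≤s z≤n))) (ℕ.≤-trans (ℕ.*-monoʳ-≤ 2 1<y) (ℕ.≤-reflexive (sym runs≡2y)))
... | inj₁ v with ℤ.<-cmp 0ℤ (height xs (suc (Valley.p v)))
...   | tri< peak _ _ = valley⇒reducible xs≢0 gc cost≡width v peak
...   | tri≈ _ 0≡h _  = returnToZero⇒reducible gc (s≤s z≤n) (Valley.p+1<t v) (sym 0≡h)
...   | tri> _ _ h<0  = ⊥-elim (ℤ.<⇒≱ h<0 (genCatalan-height-nonneg gc (suc (Valley.p v))))
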